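{- For every integer $m\ge1$, $\mathfrak{A}_{2m}\models\varphi^{3\text{ -loc}}_{grid}$. Moreover, for every $2$-data structure $\mathfrak{A}=(A,(P_\sigma),f_1,f_2)$ over $\Sigma_{grid}$, if $\mathfrak{A}\models\varphi^{3\text{ -loc}}_{grid}$ then the bi-binary structure $(A,[\varphi_H]_\mathfrak{A},[\varphi_V]_\mathfrak{A})$ is grid-like.
   Context: Data structures and local logic. A $2$-data structure over a finite set $\Sigma$ of unary predicates is $\mathfrak{A}=(A,(P_\sigma)_{\sigma\in\Sigma},f_1,f_2)$, $A$ nonempty finite, $P_\sigma\subseteq A$, $f_1,f_2:A\to\mathbb{N}$; $x\sim_{(i,j)}y$ means $f_i(x)=f_j(y)$. $\mathrm{dFO}[2,\Sigma,\Gamma]$: first-order logic with atoms $\sigma(x)$, $x\sim y$ ($\sim\in\Gamma$), $x=y$. With $\Gamma=\{\sim_{(1,1)},\sim_{(2,2)}\}$: the data graph has vertices $A\times\{1,2\}$ and directed edges $(a,i)\to(b,j)$ iff ($a=b$, $i\ne j$) or ($\sim_{(i,j)}\in\Gamma$ and $f_i(a)=f_j(b)$); $B_r(a)$ is the set of vertices at directed distance $\le r$ from $(a,1)$ or $(a,2)$; the $r$-view $\mathfrak{A}|^r_a$ has universe $\{b:(b,i)\in B_r(a)$ for some $i\}$, restricted predicates, $i$-th value $f_i(b)$ if $(b,i)\in B_r(a)$, else a fresh value (pairwise distinct, not among values of $\mathfrak{A}$). A local formula $\langle\psi\rangle^r_x$ ($\psi\in\mathrm{dFO}[2,\Sigma,\Gamma]$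 with at most $x$ free) holds at $I$ iff $\mathfrak{A}|^r_{I(x)}\models_I\psi$; local sentences are built from such atoms, $x=y$, $\vee,\neg,\exists$. Grids. A bi-binary structure is $(A,R_1,R_2)$ with $A$ finite and $R_1,R_2\subseteq A\times A$; it is grid-like if for some $m\ge1$ there is a map $\pi$ from $\mathbb{Z}_m\times\mathbb{Z}_m$ to $A$ with $(\pi(p),\pi(q))\in R_1$ whenever $(p,q)\in H_m$ and $(\pi(p),\pi(q))\in R_2$ whenever $(p,q)\in V_m$, where $H_m=\{((i,j),(i',j)):i'-i\equiv1\bmod m\}$, $V_m=\{((i,j),(i,j')):j'-j\equiv1\bmod m\}$. For a formula $\varphi(x,y)$, $[\varphi]_\mathfrak{A}=\{(a,b)\in A^2:\mathfrak{A}\models\varphi(a,b)\}$. $\Sigma_{grid}=\{H_0,H_1,V_0,V_1\}$. $\varphi_H(x,y)$ is the disjunction of $H_0(x)\wedge H_1(y)\wedge V_0(x)\wedge V_0(y)\wedge x\sim_{(1,1)}y$; $H_1(x)\wedge H_0(y)\wedge V_0(x)\wedge V_0(y)\wedge x\sim_{(2,2)}y$; $H_0(x)\wedge H_1(y)\wedge V_1(x)\wedge V_1(y)\wedge x\sim_{(1,1)}y$; $H_1(x)\wedge H_0(y)\wedge V_1(x)\wedge V_1(y)\wedge x\sim_{(2,2)}y$. $\varphi_V(x,y)$ is the disjunction of $H_0(x)\wedge H_0(y)\wedge V_0(x)\wedge V_1(y)\wedge x\sim_{(1,1)}y$; $H_1(x)\wedge H_1(y)\wedge V_0(x)\wedge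 V_1(y)\wedge x\sim_{(1,1)}y$; $H_0(x)\wedge H_0(y)\wedge V_1(x)\wedge V_0(y)\wedge x\sim_{(2,2)}y$; $H_1(x)\wedge H_1(y)\wedge V_1(x)\wedge V_0(y)\wedge x\sim_{(2,2)}y$. $\varphi^{3\text{ -loc}}_{grid}=\forall x.\langle\forall y\forall x'\forall y'.(\varphi_H(x,y)\wedge\varphi_V(x,x')\wedge\varphi_V(y,y'))\to\varphi_H(x',y')\rangle^3_x\wedge\forall x.\langle\exists y.\varphi_H(x,y)\wedge\exists y.\varphi_V(x,y)\rangle^3_x\wedge\forall x.\langle(H_0(x)\oplus H_1(x))\wedge(V_0(x)\oplus V_1(x))\rangle^3_x$. $\mathfrak{A}_{2m}$: universe $\mathbb{Z}_{2m}\times\mathbb{Z}_{2m}$ (with $\mathbb{Z}_n=\{0,\dots,n-1\}$); $P_{H_k}=\{(i,j):i\equiv k\bmod 2\}$, $P_{V_k}=\{(i,j):j\equiv k\bmod 2\}$ for $k\in\{0,1\}$; $f_1(i,j)=(\lfloor i/2\rfloor\bmod m)+m\cdot(\lfloor j/2\rfloor\bmod m)$; and for $i,j\in\{1,\dots,2m\}$, $f_2(i\bmod 2m,j\bmod 2m)=f_1(i-1,j-1)$. -}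

module Defs where

open import Data.Nat using (ℕ; zero; suc; _+_; _*_; _∸_; _/_; _%_; _≡ᵇ_; NonZero)
open import Data.Bool using (Bool; true; false)
open import Data.Fin using (Fin; toℕ)
open import Data.Product using (Σ; _×_; _,_; proj₁; proj₂; ∃)
open import Data.Sum using (_⊎_; inj₁; inj₂)
open import Relation.Binary.PropositionalEquality using (_≡_; _≢_)
open import Relation.Nullary using (¬_)

data Σgrid : Set where
  H₀ H₁ V₀ V₁ : Σgrid

data Idx : Set where
  ① ② : Idx

-- 2-data structures over Σ_grid (universe an arbitrary type A;
-- finiteness/nonemptiness is imposed in the statement by A = Fin (suc n)
-- or by the concrete grid universe).

record DataStructure (A : Set) : Set where
  field
    P  : Σgrid → A → Bool
    f₁ : A → ℕ
    f₂ : A → ℕ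

  val : Idx → A → ℕ
  val ① = f₁
  val ② = f₂

open DataStructure public

-- "Interpretations" in which the formulas of dFO[2,Σ_grid,Γ],
-- Γ = {∼(1,1), ∼(2,2)}, are evaluated: a universe, the unary predicates,
-- and the meaning of the atoms x ∼(i,i) y.

record Interp : Set₁ where
  field
    Carrier : Set
    Holds   : Σgrid → Carrier → Set
    Sim     : Idx → Carrier → Carrier → Set

open Interp public

⟦_⟧ : {A : Set} → DataStructure A → Interp
⟦_⟧ {A} 𝔄 = record
  { Carrier = A
  ; Holds   = λ σ a → P 𝔄 σ a ≡ true
  ; Sim     = λ i a b → val 𝔄 i a ≡ val 𝔄 i b
  }

module _ {A : Set} (𝔄 : DataStructure A) where

  Vertex : Set
  Vertex = A × Idx

  -- (a,i) → (b,j)  iff  (a = b and i ≠ j)  or  (∼(i,j) ∈ Γ, i.e. i = j, and f_i(a) = f_j(b))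
  Edge : Vertex → Vertex → Set
  Edge (a , i) (b , j) = (a ≡ b × i ≢ j) ⊎ (i ≡ j × val 𝔄 i a ≡ val 𝔄 j b)

  data Within : ℕ → Vertex → Vertex → Set where
    stay : ∀ {r u} → Within r u u
    step : ∀ {r u w v} → Edge u w → Within r w v → Within (suc r) u v

  InBall : ℕ → A → Vertex → Set
  InBall r a v = Within r (a , ①) v ⊎ Within r (a , ②) v

  InView : ℕ → A → A → Set
  InView r a b = Σ Idx λ i → InBall r a (b , i)

  -- The i-th value of b is f_i(b)
  -- if (b,i) ∈ B_r(a) and otherwise a fresh value, fresh values being
  -- pairwise distinct and distinct from all values of 𝔄.  Hence the i-th
  -- values of b and b' coincide iff both are in the ball with equal f_i,
  -- or both are fresh and (b,i) = (b',i), i.e. b = b'.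
  View : ℕ → A → Interp
  View r a = record
    { Carrier = Σ A (InView r a)
    ; Holds   = λ σ x → P 𝔄 σ (proj₁ x) ≡ true
    ; Sim     = λ i x y →
        (InBall r a (proj₁ x , i) × InBall r a (proj₁ y , i)
            × val 𝔄 i (proj₁ x) ≡ val 𝔄 i (proj₁ y))
        ⊎ (¬ InBall r a (proj₁ x , i) × ¬ InBall r a (proj₁ y , i)
            × proj₁ x ≡ proj₁ y)
    }

  centre : (r : ℕ) (a : A) → Carrier (View r a)
  centre r a = a , ① , inj₁ stay

_⊕_ : Set → Set → Set
X ⊕ Y = (X × ¬ Y) ⊎ (¬ X × Y)

module _ (S : Interp) where

  φH : Carrier S → Carrier S → Set
  φH x y =
      (Holds S H₀ x × Holds S H₁ y × Holds S V₀ x × Holds S V₀ y × Sim S ① x y)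
    ⊎ (Holds S H₁ x × Holds S H₀ y × Holds S V₀ x × Holds S V₀ y × Sim S ② x y)
    ⊎ (Holds S H₀ x × Holds S H₁ y × Holds S V₁ x × Holds S V₁ y × Sim S ① x y)
    ⊎ (Holds S H₁ x × Holds S H₀ y × Holds S V₁ x × Holds S V₁ y × Sim S ② x y)

  φV : Carrier S → Carrier S → Set
  φV x y =
      (Holds S H₀ x × Holds S H₀ y × Holds S V₀ x × Holds S V₁ y × Sim S ① x y)
    ⊎ (Holds S H₁ x × Holds S H₁ y × Holds S V₀ x × Holds S V₁ y × Sim S ① x y)
    ⊎ (Holds S H₀ x × Holds S H₀ y × Holds S V₁ x × Holds S V₀ y × Sim S ② x y)
    ⊎ (Holds S H₁ x × Holds S H₁ y × Holds S V₁ x × Holds S V₀ y × Sim S ② x y)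

  ψ₁ : Carrier S → Set
  ψ₁ x = ∀ y x' y' → φH x y × φV x x' × φV y y' → φH x' y'

  ψ₂ : Carrier S → Set
  ψ₂ x = (∃ λ y → φH x y) × (∃ λ y → φV x y)

  ψ₃ : Carrier S → Set
  ψ₃ x = (Holds S H₀ x ⊕ Holds S H₁ x) × (Holds S V₀ x ⊕ Holds S V₁ x)

Local : {A : Set} (𝔄 : DataStructure A) (r : ℕ)
        (ψ : (S : Interp) → Carrier S → Set) → A → Set
Local 𝔄 r ψ a = ψ (View 𝔄 r a) (centre 𝔄 r a)

Models-φgrid : {A : Set} → DataStructure A → Set
Models-φgrid {A} 𝔄 =
    (∀ (a : A) → Local 𝔄 3 ψ₁ a)
  × (∀ (a : A) → Local 𝔄 3 ψ₂ a)
  × (∀ (a : A) → Local 𝔄 3 ψ₃ a)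

-- Grid-like bi-binary structures  (ℤ_m = Fin m, m = suc k ≥ 1)

GridLike : {A : Set} → (A → A → Set) → (A → A → Set) → Set
GridLike {A} R₁ R₂ =
  Σ ℕ λ k → Σ (Fin (suc k) × Fin (suc k) → A) λ π →
      (∀ i j i' j' → j ≡ j' → toℕ i' % suc k ≡ suc (toℕ i) % suc k
                   → R₁ (π (i , j)) (π (i' , j')))
    × (∀ i j i' j' → i ≡ i' → toℕ j' % suc k ≡ suc (toℕ j) % suc k
                   → R₂ (π (i , j)) (π (i' , j')))

module _ (m : ℕ) .{{_ : NonZero m}} where

  f₁-grid : ℕ → ℕ → ℕ
  f₁-grid i j = (i / 2) % m + m * ((j / 2) % m)

  -- for i' ∈ ℤ_{2m}: the i ∈ {1,…,2m} with i mod 2m = i', minus 1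
  predMod : ℕ → ℕ
  predMod zero    = 2 * m ∸ 1
  predMod (suc i) = i

  hasParity : ℕ → Fin (2 * m) → Bool
  hasParity k i = toℕ i % 2 ≡ᵇ k

  𝔄grid : DataStructure (Fin (2 * m) × Fin (2 * m))
  𝔄grid = record
    { P  = λ { H₀ (i , j) → hasParity 0 i
             ; H₁ (i , j) → hasParity 1 i
             ; V₀ (i , j) → hasParity 0 j
             ; V₁ (i , j) → hasParity 1 j }
    ; f₁ = λ { (i , j) → f₁-grid (toℕ i) (toℕ j) }
    ; f₂ = λ { (i , j) → f₁-grid (predMod (toℕ i)) (predMod (toℕ j)) }
    }

-- Every element that ψ₁ or ψ₂ mentions at a is one data edge away from a point both of
-- whose copies lie in the 2-ball around a (a itself, or a point sharing a value with a).
-- So it lies in the 3-view, where the data equalities it takes part in are those of 𝔄;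
-- hence the 3-local sentence is equivalent to its global version.
--
-- In 𝔄_{2m}, f₁ identifies the 2 × 2 blocks with even corners and f₂ the blocks shifted
-- by one, so φ_H and φ_V are the graphs of the commuting cyclic shifts of the two
-- coordinates.  Conversely, in a finite model choose φ_H- and φ_V-successors h and v; the
-- square axiom says that v preserves φ_H.  On an n-element set fⁿ maps into the cycles
-- of f, where n! is a common period, so (i , j) ↦ vʲ(vⁿ(hⁱ(hⁿ a₀))) over ℤ_{n!} is a grid.

module Submission where

open import Defs
open import Algebra.Properties.CommutativeSemigroup using (x∙yz≈y∙xz)
open import Data.Bool using (T; true)
open import Data.Empty using (⊥-elim)
open import Data.Fin using (Fin; toℕ)
import Data.Fin as Fin
open import Data.Fin.Properties using (pigeonhole; toℕ<n; toℕ-fromℕ<; toℕ-injective)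
open import Data.Nat using (ℕ; zero; suc; pred; _+_; _*_; _∸_; _%_; _/_; _!; _<_; _≤_; _≡ᵇ_;
  NonZero; >-nonZero; >-nonZero⁻¹; s≤s; z≤n; s≤s⁻¹)
open import Data.Nat.Divisibility using (_∣_; m∣m*n; ∣-trans; m≤n⇒m!∣n!)
open import Data.Nat.DivMod using (_mod_; m≡m%n+[m/n]*n; m/n≡1+[m∸n]/n; [m+kn]%n≡m%n;
  m<n⇒m%n≡m; n%n≡0; m%n<n; m<n*o⇒m/o<n)
open import Data.Nat.Properties
open import Data.Product using (_×_; _,_; proj₁; proj₂; ∃)
open import Data.Sum using (_⊎_; inj₁; inj₂)
open import Function using (id; _⇔_; mk⇔; Equivalence)
import Function.Endo.Propositional as Endo
open import Level using (0ℓ)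
open import Relation.Binary.Core using (Rel; _Preserves_⟶_)
open import Relation.Binary.PropositionalEquality
open import Relation.Nullary using (¬_)

module _ {S T : Interp} {x y : Carrier S} {x′ y′ : Carrier T}
         (holdsˡ : ∀ σ → Holds S σ x → Holds T σ x′)
         (holdsʳ : ∀ σ → Holds S σ y → Holds T σ y′)
         (sim : ∀ k → Sim S k x y → Sim T k x′ y′) where

  φH-map : φH S x y → φH T x′ y′
  φH-map (inj₁ (p , q , r , s , e)) =
    inj₁ (holdsˡ H₀ p , holdsʳ H₁ q , holdsˡ V₀ r , holdsʳ V₀ s , sim ① e)
  φH-map (inj₂ (inj₁ (p , q , r , s , e))) =
    inj₂ (inj₁ (holdsˡ H₁ p , holdsʳ H₀ q , holdsˡ V₀ r , holdsʳ V₀ s , sim ② e))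
  φH-map (inj₂ (inj₂ (inj₁ (p , q , r , s , e)))) =
    inj₂ (inj₂ (inj₁ (holdsˡ H₀ p , holdsʳ H₁ q , holdsˡ V₁ r , holdsʳ V₁ s , sim ① e)))
  φH-map (inj₂ (inj₂ (inj₂ (p , q , r , s , e)))) =
    inj₂ (inj₂ (inj₂ (holdsˡ H₁ p , holdsʳ H₀ q , holdsˡ V₁ r , holdsʳ V₁ s , sim ② e)))

  φV-map : φV S x y → φV T x′ y′
  φV-map (inj₁ (p , q , r , s , e)) =
    inj₁ (holdsˡ H₀ p , holdsʳ H₀ q , holdsˡ V₀ r , holdsʳ V₁ s , sim ① e)
  φV-map (inj₂ (inj₁ (p , q , r , s , e))) =
    inj₂ (inj₁ (holdsˡ H₁ p , holdsʳ H₁ q , holdsˡ V₀ r , holdsʳ V₁ s , sim ① e))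
  φV-map (inj₂ (inj₂ (inj₁ (p , q , r , s , e)))) =
    inj₂ (inj₂ (inj₁ (holdsˡ H₀ p , holdsʳ H₀ q , holdsˡ V₁ r , holdsʳ V₀ s , sim ② e)))
  φV-map (inj₂ (inj₂ (inj₂ (p , q , r , s , e)))) =
    inj₂ (inj₂ (inj₂ (holdsˡ H₁ p , holdsʳ H₁ q , holdsˡ V₁ r , holdsʳ V₀ s , sim ② e)))

module _ (S : Interp) {x y : Carrier S} where

  φH⇒Sim : φH S x y → ∃ λ k → Sim S k x y
  φH⇒Sim (inj₁ (_ , _ , _ , _ , e))                = ① , e
  φH⇒Sim (inj₂ (inj₁ (_ , _ , _ , _ , e)))         = ② , e
  φH⇒Sim (inj₂ (inj₂ (inj₁ (_ , _ , _ , _ , e)))) = ① , e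
  φH⇒Sim (inj₂ (inj₂ (inj₂ (_ , _ , _ , _ , e)))) = ② , e

  φV⇒Sim : φV S x y → ∃ λ k → Sim S k x y
  φV⇒Sim (inj₁ (_ , _ , _ , _ , e))                = ① , e
  φV⇒Sim (inj₂ (inj₁ (_ , _ , _ , _ , e)))         = ① , e
  φV⇒Sim (inj₂ (inj₂ (inj₁ (_ , _ , _ , _ , e)))) = ② , e
  φV⇒Sim (inj₂ (inj₂ (inj₂ (_ , _ , _ , _ , e)))) = ② , e

module LocalView {A : Set} (𝔄 : DataStructure A) where

  Within-suc : ∀ {r u v} → Within 𝔄 r u v → Within 𝔄 (suc r) u v
  Within-suc stay       = stay
  Within-suc (step e w) = step e (Within-suc w)

  Within-snoc : ∀ {r u v w} → Within 𝔄 r u v → Edge 𝔄 v w → Within 𝔄 (suc r) u w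
  Within-snoc stay        e = step e stay
  Within-snoc (step e′ w) e = step e′ (Within-snoc w e)

  InBall-suc : ∀ {r a v} → InBall 𝔄 r a v → InBall 𝔄 (suc r) a v
  InBall-suc (inj₁ w) = inj₁ (Within-suc w)
  InBall-suc (inj₂ w) = inj₂ (Within-suc w)

  InBall-snoc : ∀ {r a v w} → InBall 𝔄 r a v → Edge 𝔄 v w → InBall 𝔄 (suc r) a w
  InBall-snoc (inj₁ w) e = inj₁ (Within-snoc w e)
  InBall-snoc (inj₂ w) e = inj₂ (Within-snoc w e)

  InBall-centre : ∀ {r} a k → InBall 𝔄 r a (a , k)
  InBall-centre a ① = inj₁ stay
  InBall-centre a ② = inj₂ stay

  Sim⇒Edge : ∀ {x y} k → Sim ⟦ 𝔄 ⟧ k x y → Edge 𝔄 (x , k) (y , k)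
  Sim⇒Edge k e = inj₂ (refl , e)

  Near : A → A → Set
  Near a x = ∀ k → InBall 𝔄 2 a (x , k)

  Near-refl : ∀ a → Near a a
  Near-refl a k = InBall-centre a k

  Sim⇒Near : ∀ {a x} → ∃ (λ k → Sim ⟦ 𝔄 ⟧ k a x) → Near a x
  Sim⇒Near {a} (① , e) ① = InBall-suc (InBall-snoc (InBall-centre a ①) (Sim⇒Edge ① e))
  Sim⇒Near {a} (① , e) ② =
    InBall-snoc (InBall-snoc (InBall-centre a ①) (Sim⇒Edge ① e)) (inj₁ (refl , λ ()))
  Sim⇒Near {a} (② , e) ① =
    InBall-snoc (InBall-snoc (InBall-centre a ②) (Sim⇒Edge ② e)) (inj₁ (refl , λ ()))
  Sim⇒Near {a} (② , e) ② = InBall-suc (InBall-snoc (InBall-centre a ②) (Sim⇒Edge ② e))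

  module _ {a : A} where

    private
      V : Interp
      V = View 𝔄 3 a

    viewPoint : ∀ {x} → Near a x → Carrier V
    viewPoint {x} n = x , ① , InBall-suc (n ①)

    viewNeighbour : ∀ {x y} → Near a x → ∃ (λ k → Sim ⟦ 𝔄 ⟧ k x y) → Carrier V
    viewNeighbour {y = y} n (k , e) = y , k , InBall-snoc (n k) (Sim⇒Edge k e)

    Sim-lower : ∀ (x̂ ŷ : Carrier V) k → Sim V k x̂ ŷ → Sim ⟦ 𝔄 ⟧ k (proj₁ x̂) (proj₁ ŷ)
    Sim-lower x̂ ŷ k (inj₁ (_ , _ , e)) = e
    Sim-lower x̂ ŷ k (inj₂ (_ , _ , e)) = cong (val 𝔄 k) e

    Sim-lift : ∀ (x̂ ŷ : Carrier V) → Near a (proj₁ x̂) →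
               ∀ k → Sim ⟦ 𝔄 ⟧ k (proj₁ x̂) (proj₁ ŷ) → Sim V k x̂ ŷ
    Sim-lift x̂ ŷ n k e = inj₁ (InBall-suc (n k) , InBall-snoc (n k) (Sim⇒Edge k e) , e)

    φH-lower : ∀ x̂ ŷ → φH V x̂ ŷ → φH ⟦ 𝔄 ⟧ (proj₁ x̂) (proj₁ ŷ)
    φH-lower x̂ ŷ =
      φH-map {V} {⟦ 𝔄 ⟧} {x̂} {ŷ} {proj₁ x̂} {proj₁ ŷ} (λ _ → id) (λ _ → id) (Sim-lower x̂ ŷ)

    φV-lower : ∀ x̂ ŷ → φV V x̂ ŷ → φV ⟦ 𝔄 ⟧ (proj₁ x̂) (proj₁ ŷ)
    φV-lower x̂ ŷ =
      φV-map {V} {⟦ 𝔄 ⟧} {x̂} {ŷ} {proj₁ x̂} {proj₁ ŷ} (λ _ → id) (λ _ → id) (Sim-lower x̂ ŷ)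

    φH-lift : ∀ x̂ ŷ → Near a (proj₁ x̂) → φH ⟦ 𝔄 ⟧ (proj₁ x̂) (proj₁ ŷ) → φH V x̂ ŷ
    φH-lift x̂ ŷ n =
      φH-map {⟦ 𝔄 ⟧} {V} {proj₁ x̂} {proj₁ ŷ} {x̂} {ŷ} (λ _ → id) (λ _ → id) (Sim-lift x̂ ŷ n)

    φV-lift : ∀ x̂ ŷ → Near a (proj₁ x̂) → φV ⟦ 𝔄 ⟧ (proj₁ x̂) (proj₁ ŷ) → φV V x̂ ŷ
    φV-lift x̂ ŷ n =
      φV-map {⟦ 𝔄 ⟧} {V} {proj₁ x̂} {proj₁ ŷ} {x̂} {ŷ} (λ _ → id) (λ _ → id) (Sim-lift x̂ ŷ n)

  ψ₁-local⇔global : ∀ a → Local 𝔄 3 ψ₁ a ⇔ ψ₁ ⟦ 𝔄 ⟧ a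
  ψ₁-local⇔global a = mk⇔ to from
    where
      ĉ : Carrier (View 𝔄 3 a)
      ĉ = centre 𝔄 3 a

      to : Local 𝔄 3 ψ₁ a → ψ₁ ⟦ 𝔄 ⟧ a
      to loc y x′ y′ (h , v , v′) =
        φH-lower x̂′ ŷ′ (loc ŷ x̂′ ŷ′ (φH-lift ĉ ŷ (Near-refl a) h ,
                                    φV-lift ĉ x̂′ (Near-refl a) v ,
                                    φV-lift ŷ ŷ′ y-near v′))
        where
          y-near : Near a y
          y-near = Sim⇒Near (φH⇒Sim ⟦ 𝔄 ⟧ h)
          ŷ x̂′ ŷ′ : Carrier (View 𝔄 3 a)
          ŷ  = viewPoint y-near
          x̂′ = viewPoint (Sim⇒Near (φV⇒Sim ⟦ 𝔄 ⟧ v))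
          ŷ′ = viewNeighbour y-near (φV⇒Sim ⟦ 𝔄 ⟧ v′)

      from : ψ₁ ⟦ 𝔄 ⟧ a → Local 𝔄 3 ψ₁ a
      from glob ŷ x̂′ ŷ′ (h , v , v′) =
        φH-lift x̂′ ŷ′ (Sim⇒Near (φV⇒Sim ⟦ 𝔄 ⟧ v↓))
          (glob (proj₁ ŷ) (proj₁ x̂′) (proj₁ ŷ′) (φH-lower ĉ ŷ h , v↓ , φV-lower ŷ ŷ′ v′))
        where
          v↓ : φV ⟦ 𝔄 ⟧ a (proj₁ x̂′)
          v↓ = φV-lower ĉ x̂′ v

  ψ₂-local⇔global : ∀ a → Local 𝔄 3 ψ₂ a ⇔ ψ₂ ⟦ 𝔄 ⟧ a
  ψ₂-local⇔global a = mk⇔ to from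
    where
      ĉ : Carrier (View 𝔄 3 a)
      ĉ = centre 𝔄 3 a

      to : Local 𝔄 3 ψ₂ a → ψ₂ ⟦ 𝔄 ⟧ a
      to ((ŷ , h) , (ẑ , v)) = (proj₁ ŷ , φH-lower ĉ ŷ h) , (proj₁ ẑ , φV-lower ĉ ẑ v)

      from : ψ₂ ⟦ 𝔄 ⟧ a → Local 𝔄 3 ψ₂ a
      from ((y , h) , (z , v)) =
          (ŷ , φH-lift ĉ ŷ (Near-refl a) h) , (ẑ , φV-lift ĉ ẑ (Near-refl a) v)
        where
          ŷ ẑ : Carrier (View 𝔄 3 a)
          ŷ = viewNeighbour (Near-refl a) (φH⇒Sim ⟦ 𝔄 ⟧ h)
          ẑ = viewNeighbour (Near-refl a) (φV⇒Sim ⟦ 𝔄 ⟧ v)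

Global-φgrid : Interp → Set
Global-φgrid S = (∀ a → ψ₁ S a) × (∀ a → ψ₂ S a) × (∀ a → ψ₃ S a)

φgrid-local⇔global : ∀ {A} (𝔄 : DataStructure A) → Models-φgrid 𝔄 ⇔ Global-φgrid ⟦ 𝔄 ⟧
φgrid-local⇔global 𝔄 = mk⇔
  (λ (l₁ , l₂ , l₃) → (λ a → to (ψ₁-local⇔global a) (l₁ a)) ,
                      (λ a → to (ψ₂-local⇔global a) (l₂ a)) , l₃)
  (λ (g₁ , g₂ , g₃) → (λ a → from (ψ₁-local⇔global a) (g₁ a)) ,
                      (λ a → from (ψ₂-local⇔global a) (g₂ a)) , g₃)
  where
    open LocalView 𝔄
    open Equivalence

module Iterate {A : Set} where

  open Endo A public using (_^_)

  ^-+ : ∀ (f : A → A) s t x → (f ^ (s + t)) x ≡ (f ^ s) ((f ^ t) x)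
  ^-+ f s t x = cong-app (Endo.^-homo A f s t) x

  ^-preserves : ∀ (f : A → A) {R : Rel A 0ℓ} → f Preserves R ⟶ R →
                ∀ t {x y} → R x y → R ((f ^ t) x) ((f ^ t) y)
  ^-preserves f pres zero    r = r
  ^-preserves f {R} pres (suc t) r = pres (^-preserves f {R} pres t r)

  ^-*-fixed : ∀ (f : A → A) {d y} → (f ^ d) y ≡ y → ∀ q → (f ^ (q * d)) y ≡ y
  ^-*-fixed f         fix zero    = refl
  ^-*-fixed f {d} {y} fix (suc q) = begin
    (f ^ (d + q * d)) y       ≡⟨ ^-+ f d (q * d) y ⟩
    (f ^ d) ((f ^ (q * d)) y) ≡⟨ cong (f ^ d) (^-*-fixed f fix q) ⟩
    (f ^ d) y                 ≡⟨ fix ⟩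
    y                         ∎
    where open ≡-Reasoning

open Iterate

module Periodic {A : Set} (f : A → A) {p} .{{_ : NonZero p}} {y} (fix : (f ^ p) y ≡ y) where

  ^-mod : ∀ t → (f ^ t) y ≡ (f ^ (t % p)) y
  ^-mod t = begin
    (f ^ t) y                           ≡⟨ cong (λ s → (f ^ s) y) (m≡m%n+[m/n]*n t p) ⟩
    (f ^ (t % p + t / p * p)) y         ≡⟨ ^-+ f (t % p) (t / p * p) y ⟩
    (f ^ (t % p)) ((f ^ (t / p * p)) y) ≡⟨ cong (f ^ (t % p)) (^-*-fixed f fix (t / p)) ⟩
    (f ^ (t % p)) y                     ∎
    where open ≡-Reasoning

  ^-suc-mod : ∀ {t t′} → t′ % p ≡ suc t % p → (f ^ t′) y ≡ f ((f ^ t) y)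
  ^-suc-mod {t} {t′} e = begin
    (f ^ t′) y          ≡⟨ ^-mod t′ ⟩
    (f ^ (t′ % p)) y    ≡⟨ cong (λ s → (f ^ s) y) e ⟩
    (f ^ (suc t % p)) y ≡⟨ ^-mod (suc t) ⟨
    f ((f ^ t) y)       ∎
    where open ≡-Reasoning

n∣n! : ∀ {n} → NonZero n → n ∣ n !
n∣n! {suc n} _ = m∣m*n (n !)

-- Pigeonhole gives fᵃ x = fᵇ x with a < b ≤ n; since b ∸ a divides n!, n! is a period of fᵃ x.
^-factorial-fixed : ∀ {n} (f : Fin n → Fin n) x → (f ^ (n !)) ((f ^ n) x) ≡ (f ^ n) x
^-factorial-fixed {n} f x with pigeonhole (n<1+n n) (λ t → (f ^ toℕ t) x)
... | i , j , i<j , fⁱ≡fʲ = begin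
    (f ^ (n !)) ((f ^ n) x)                   ≡⟨ ^-+ f (n !) n x ⟨
    (f ^ (n ! + n)) x                         ≡⟨ cong (λ s → (f ^ s) x) exponent ⟩
    (f ^ (n ∸ a + (q * d + a))) x             ≡⟨ ^-+ f (n ∸ a) (q * d + a) x ⟩
    (f ^ (n ∸ a)) ((f ^ (q * d + a)) x)       ≡⟨ cong (f ^ (n ∸ a)) (^-+ f (q * d) a x) ⟩
    (f ^ (n ∸ a)) ((f ^ (q * d)) ((f ^ a) x)) ≡⟨ cong (f ^ (n ∸ a)) (^-*-fixed f cycle q) ⟩
    (f ^ (n ∸ a)) ((f ^ a) x)                 ≡⟨ ^-+ f (n ∸ a) a x ⟨
    (f ^ (n ∸ a + a)) x                       ≡⟨ cong (λ s → (f ^ s) x) (m∸n+n≡m a≤n) ⟩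
    (f ^ n) x                                 ∎
  where
    open ≡-Reasoning
    a b d : ℕ
    a = toℕ i
    b = toℕ j
    d = b ∸ a
    b≤n : b ≤ n
    b≤n = s≤s⁻¹ (toℕ<n j)
    a≤n : a ≤ n
    a≤n = ≤-trans (<⇒≤ i<j) b≤n
    cycle : (f ^ d) ((f ^ a) x) ≡ (f ^ a) x
    cycle = begin
      (f ^ d) ((f ^ a) x) ≡⟨ ^-+ f d a x ⟨
      (f ^ (d + a)) x     ≡⟨ cong (λ s → (f ^ s) x) (m∸n+n≡m (<⇒≤ i<j)) ⟩
      (f ^ b) x           ≡⟨ fⁱ≡fʲ ⟨
      (f ^ a) x           ∎
    d∣n! : d ∣ n !
    d∣n! = ∣-trans (n∣n! (>-nonZero (m<n⇒0<n∸m i<j)))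
                   (m≤n⇒m!∣n! (≤-trans (m∸n≤m b a) b≤n))
    q : ℕ
    q = _∣_.quotient d∣n!
    exponent : n ! + n ≡ n ∸ a + (q * d + a)
    exponent = begin
      n ! + n               ≡⟨ cong₂ _+_ (_∣_.equality d∣n!) (sym (m∸n+n≡m a≤n)) ⟩
      q * d + (n ∸ a + a)   ≡⟨ x∙yz≈y∙xz +-commutativeSemigroup (q * d) (n ∸ a) a ⟩
      n ∸ a + (q * d + a)   ∎

successors⇒GridLike : ∀ {n} {R₁ R₂ : Rel (Fin (suc n)) 0ℓ}
  (h v : Fin (suc n) → Fin (suc n)) →
  (∀ x → R₁ x (h x)) → (∀ x → R₂ x (v x)) → v Preserves R₁ ⟶ R₁ →
  GridLike R₁ R₂
successors⇒GridLike {n} {R₁} {R₂} h v R₁-h R₂-v v-preserves-R₁ = k , π , horizontal , vertical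
  where
    N k : ℕ
    N = suc n
    k = pred (N !)

    period : ∀ (f : Fin N → Fin N) x → (f ^ suc k) ((f ^ N) x) ≡ (f ^ N) x
    period f x = trans (cong (λ p → (f ^ p) ((f ^ N) x)) (suc-pred (N !) {{N !≢0}}))
                       (^-factorial-fixed f x)

    column : Fin (suc k) → Fin N
    column i = (h ^ toℕ i) ((h ^ N) Fin.zero)

    π : Fin (suc k) × Fin (suc k) → Fin N
    π (i , j) = (v ^ toℕ j) ((v ^ N) (column i))

    horizontal : ∀ i j i′ j′ → j ≡ j′ → toℕ i′ % suc k ≡ suc (toℕ i) % suc k →
                 R₁ (π (i , j)) (π (i′ , j′))
    horizontal i j i′ .j refl e =
      subst (λ z → R₁ (π (i , j)) ((v ^ toℕ j) ((v ^ N) z)))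
            (sym (Periodic.^-suc-mod h (period h Fin.zero) {toℕ i} {toℕ i′} e))
            (vᵗ-preserves (toℕ j) (vᵗ-preserves N (R₁-h (column i))))
      where
        vᵗ-preserves : ∀ t {x y} → R₁ x y → R₁ ((v ^ t) x) ((v ^ t) y)
        vᵗ-preserves = ^-preserves v {R₁} v-preserves-R₁

    vertical : ∀ i j i′ j′ → i ≡ i′ → toℕ j′ % suc k ≡ suc (toℕ j) % suc k →
               R₂ (π (i , j)) (π (i′ , j′))
    vertical i j .i j′ refl e =
      subst (R₂ (π (i , j))) (sym (Periodic.^-suc-mod v (period v (column i)) {toℕ j} {toℕ j′} e))
            (R₂-v (π (i , j)))

-- Stated in the form into which the predicates H₀, H₁, V₀, V₁ of 𝔄grid unfold.
Even Odd : ℕ → Set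
Even c = (c % 2 ≡ᵇ 0) ≡ true
Odd  c = (c % 2 ≡ᵇ 1) ≡ true

SameParity : ℕ → ℕ → Set
SameParity c d = (Even c × Even d) ⊎ (Odd c × Odd d)

even⊎odd : ∀ c → Even c ⊎ Odd c
even⊎odd zero          = inj₁ refl
even⊎odd (suc zero)    = inj₂ refl
even⊎odd (suc (suc c)) = even⊎odd c

even⇒¬odd : ∀ c → Even c → ¬ Odd c
even⇒¬odd zero       _ ()
even⇒¬odd (suc zero) ()
even⇒¬odd (suc (suc c)) = even⇒¬odd c

even⊕odd : ∀ c → Even c ⊕ Odd c
even⊕odd c with even⊎odd c
... | inj₁ e = inj₁ (e , even⇒¬odd c e)
... | inj₂ o = inj₂ ((λ e → even⇒¬odd c e o) , o)

even⇒odd-suc : ∀ c → Even c → Odd (suc c)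
even⇒odd-suc zero        _ = refl
even⇒odd-suc (suc (suc c)) e = even⇒odd-suc c e

odd⇒even-suc : ∀ c → Odd c → Even (suc c)
odd⇒even-suc (suc zero)    _ = refl
odd⇒even-suc (suc (suc c)) o = odd⇒even-suc c o

even-suc⇒odd : ∀ c → Even (suc c) → Odd c
even-suc⇒odd (suc zero)    _ = refl
even-suc⇒odd (suc (suc c)) e = even-suc⇒odd c e

odd-suc⇒even : ∀ c → Odd (suc c) → Even c
odd-suc⇒even zero        _ = refl
odd-suc⇒even (suc (suc c)) o = odd-suc⇒even c o

even-2* : ∀ m → Even (2 * m)
even-2* zero    = refl
even-2* (suc m) = subst Even (sym (*-suc 2 m)) (even-2* m)

≡ᵇ-true⇒≡ : ∀ {a b} → (a ≡ᵇ b) ≡ true → a ≡ b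
≡ᵇ-true⇒≡ {a} {b} eq = ≡ᵇ⇒≡ a b (subst T (sym eq) _)

SameParity⇒%≡ : ∀ c d → SameParity c d → c % 2 ≡ d % 2
SameParity⇒%≡ c d (inj₁ (e , e′)) = trans (≡ᵇ-true⇒≡ e) (sym (≡ᵇ-true⇒≡ e′))
SameParity⇒%≡ c d (inj₂ (o , o′)) = trans (≡ᵇ-true⇒≡ o) (sym (≡ᵇ-true⇒≡ o′))

%-/-injective : ∀ {c d} n .{{_ : NonZero n}} → c % n ≡ d % n → c / n ≡ d / n → c ≡ d
%-/-injective {c} {d} n p q = begin
  c                  ≡⟨ m≡m%n+[m/n]*n c n ⟩
  c % n + c / n * n  ≡⟨ cong₂ (λ r s → r + s * n) p q ⟩
  d % n + d / n * n  ≡⟨ m≡m%n+[m/n]*n d n ⟨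
  d                  ∎
  where open ≡-Reasoning

[2+c]/2≡1+c/2 : ∀ c → suc (suc c) / 2 ≡ suc (c / 2)
[2+c]/2≡1+c/2 c = m/n≡1+[m∸n]/n {suc (suc c)} {2} (s≤s (s≤s z≤n))

even⇒[1+c]/2≡c/2 : ∀ c → Even c → suc c / 2 ≡ c / 2
even⇒[1+c]/2≡c/2 zero        _ = refl
even⇒[1+c]/2≡c/2 (suc (suc c)) e = begin
  suc (suc (suc c)) / 2 ≡⟨ [2+c]/2≡1+c/2 (suc c) ⟩
  suc (suc c / 2)       ≡⟨ cong suc (even⇒[1+c]/2≡c/2 c e) ⟩
  suc (c / 2)           ≡⟨ [2+c]/2≡1+c/2 c ⟨
  suc (suc c) / 2       ∎
  where open ≡-Reasoning

even-odd-/2⇒≡suc : ∀ c d → Even c → Odd d → c / 2 ≡ d / 2 → d ≡ suc c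
even-odd-/2⇒≡suc c d e o q =
  %-/-injective 2 (SameParity⇒%≡ d (suc c) (inj₂ (o , even⇒odd-suc c e)))
                  (trans (sym q) (sym (even⇒[1+c]/2≡c/2 c e)))

+-*-injective : ∀ {m a b a′ b′} .{{_ : NonZero m}} → a < m → a′ < m →
                a + m * b ≡ a′ + m * b′ → a ≡ a′ × b ≡ b′
+-*-injective {m} {a} {b} {a′} {b′} a<m a′<m eq =
  a≡a′ , *-cancelˡ-≡ b b′ m (+-cancelˡ-≡ a _ _ (trans eq (cong (_+ m * b′) (sym a≡a′))))
  where
    digit : ∀ {x} y → x < m → (x + m * y) % m ≡ x
    digit {x} y x<m =
      trans (cong (λ t → (x + t) % m) (*-comm m y)) (trans ([m+kn]%n≡m%n x y m) (m<n⇒m%n≡m x<m))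
    a≡a′ : a ≡ a′
    a≡a′ = trans (sym (digit b a<m)) (trans (cong (_% m) eq) (digit b′ a′<m))

module Grid (m : ℕ) .{{_ : NonZero m}} where

  instance
    2m≢0 : NonZero (2 * m)
    2m≢0 = m*n≢0 2 m

  C : Set
  C = Fin (2 * m)

  𝔊 : DataStructure (C × C)
  𝔊 = 𝔄grid m

  pm : ℕ → ℕ
  pm = predMod m

  suc[pm0]≡2m : suc (pm zero) ≡ 2 * m
  suc[pm0]≡2m = m+[n∸m]≡n (>-nonZero⁻¹ (2 * m))

  pm<2m : ∀ {c} → c < 2 * m → pm c < 2 * m
  pm<2m {zero}  _    = ≤-reflexive suc[pm0]≡2m
  pm<2m {suc c} c<2m = <-trans (n<1+n c) c<2m

  pm-injective : ∀ {c d} → c < 2 * m → d < 2 * m → pm c ≡ pm d → c ≡ d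
  pm-injective {zero}  {zero}  _      _      _  = refl
  pm-injective {zero}  {suc d} _      1+d<2m eq =
    ⊥-elim (<-irrefl (trans (cong suc (sym eq)) suc[pm0]≡2m) 1+d<2m)
  pm-injective {suc c} {zero}  1+c<2m _      eq =
    ⊥-elim (<-irrefl (trans (cong suc eq) suc[pm0]≡2m) 1+c<2m)
  pm-injective {suc c} {suc d} _      _      eq = cong suc eq

  pm-even : ∀ c → Even c → Odd (pm c)
  pm-even zero    _ = even-suc⇒odd (pm zero) (subst Even (sym suc[pm0]≡2m) (even-2* m))
  pm-even (suc c) e = even-suc⇒odd c e

  pm-odd : ∀ c → Odd c → Even (pm c)
  pm-odd (suc c) o = odd-suc⇒even c o

  sh : C → C
  sh i = suc (toℕ i) mod (2 * m)

  sh-cases : ∀ i → toℕ (sh i) ≡ suc (toℕ i) ⊎ (toℕ (sh i) ≡ 0 × suc (toℕ i) ≡ 2 * m)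
  sh-cases i with m≤n⇒m<n∨m≡n (toℕ<n i)
  ... | inj₁ 1+i<2m = inj₁ (trans (toℕ-fromℕ< _) (m<n⇒m%n≡m 1+i<2m))
  ... | inj₂ 1+i≡2m =
    inj₂ (trans (toℕ-fromℕ< _) (trans (cong (_% (2 * m)) 1+i≡2m) (n%n≡0 (2 * m))) , 1+i≡2m)

  toℕ-sh-even : ∀ i → Even (toℕ i) → toℕ (sh i) ≡ suc (toℕ i)
  toℕ-sh-even i e with sh-cases i
  ... | inj₁ eq        = eq
  ... | inj₂ (_ , wrap) =
    ⊥-elim (even⇒¬odd (toℕ i) e (even-suc⇒odd (toℕ i) (subst Even (sym wrap) (even-2* m))))

  sh-even⇒odd : ∀ i → Even (toℕ i) → Odd (toℕ (sh i))
  sh-even⇒odd i e = subst Odd (sym (toℕ-sh-even i e)) (even⇒odd-suc (toℕ i) e)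

  sh-odd⇒even : ∀ i → Odd (toℕ i) → Even (toℕ (sh i))
  sh-odd⇒even i o with sh-cases i
  ... | inj₁ eq       = subst Even (sym eq) (odd⇒even-suc (toℕ i) o)
  ... | inj₂ (eq , _) = subst Even (sym eq) refl

  pm-sh : ∀ i → pm (toℕ (sh i)) ≡ toℕ i
  pm-sh i with sh-cases i
  ... | inj₁ eq          = cong pm eq
  ... | inj₂ (eq , wrap) = trans (cong pm eq) (suc-injective (trans suc[pm0]≡2m (sym wrap)))

  -- f₁ pairs the coordinates 2b, 2b+1 and f₂ pairs 2b+1, 2b+2; block k c is the index of
  -- the pair containing c in the pairing used by f_k.
  pos : Idx → ℕ → ℕ
  pos ① c = c
  pos ② c = pm c

  val≡f₁-grid : ∀ k i j → val 𝔊 k (i , j) ≡ f₁-grid m (pos k (toℕ i)) (pos k (toℕ j))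
  val≡f₁-grid ① i j = refl
  val≡f₁-grid ② i j = refl

  pos<2m : ∀ k {c} → c < 2 * m → pos k c < 2 * m
  pos<2m ① c<2m = c<2m
  pos<2m ② c<2m = pm<2m c<2m

  pos-injective : ∀ k {c d} → c < 2 * m → d < 2 * m → pos k c ≡ pos k d → c ≡ d
  pos-injective ① _ _ eq = eq
  pos-injective ② = pm-injective

  pos-SameParity : ∀ k {c d} → SameParity c d → SameParity (pos k c) (pos k d)
  pos-SameParity ① p = p
  pos-SameParity ② {c} {d} (inj₁ (e , e′)) = inj₂ (pm-even c e , pm-even d e′)
  pos-SameParity ② {c} {d} (inj₂ (o , o′)) = inj₁ (pm-odd c o , pm-odd d o′)

  pos-sh : ∀ k i → Even (pos k (toℕ i)) → pos k (toℕ (sh i)) ≡ suc (pos k (toℕ i))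
  pos-sh ① i e = toℕ-sh-even i e
  pos-sh ② i e = trans (pm-sh i) (sym (suc-pm (toℕ i) e))
    where
      suc-pm : ∀ c → Even (pm c) → suc (pm c) ≡ c
      suc-pm zero    e = ⊥-elim (even⇒¬odd (pm zero) e (pm-even zero refl))
      suc-pm (suc c) _ = refl

  block : Idx → C → ℕ
  block k c = pos k (toℕ c) / 2

  f₁-grid-injective : ∀ {c d c′ d′} → c < 2 * m → d < 2 * m → c′ < 2 * m → d′ < 2 * m →
                      f₁-grid m c d ≡ f₁-grid m c′ d′ → c / 2 ≡ c′ / 2 × d / 2 ≡ d′ / 2
  f₁-grid-injective {c} {d} {c′} {d′} c< d< c′< d′< eq
    with +-*-injective (m%n<n (c / 2) m) (m%n<n (c′ / 2) m) eq
  ... | p , q = trans (sym (half%m c<)) (trans p (half%m c′<)) ,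
                trans (sym (half%m d<)) (trans q (half%m d′<))
    where
      half%m : ∀ {x} → x < 2 * m → (x / 2) % m ≡ x / 2
      half%m {x} x< = m<n⇒m%n≡m (m<n*o⇒m/o<n (subst (x <_) (*-comm 2 m) x<))

  val⇒blocks : ∀ k {i j i′ j′} → val 𝔊 k (i , j) ≡ val 𝔊 k (i′ , j′) →
               block k i ≡ block k i′ × block k j ≡ block k j′
  val⇒blocks k {i} {j} {i′} {j′} eq =
    f₁-grid-injective (pos<2m k (toℕ<n i)) (pos<2m k (toℕ<n j))
                      (pos<2m k (toℕ<n i′)) (pos<2m k (toℕ<n j′))
      (trans (sym (val≡f₁-grid k i j)) (trans eq (val≡f₁-grid k i′ j′)))

  blocks⇒val : ∀ k {i j i′ j′} → block k i ≡ block k i′ → block k j ≡ block k j′ →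
               val 𝔊 k (i , j) ≡ val 𝔊 k (i′ , j′)
  blocks⇒val k {i} {j} {i′} {j′} p q =
    trans (val≡f₁-grid k i j)
          (trans (cong₂ (λ a b → a % m + m * (b % m)) p q) (sym (val≡f₁-grid k i′ j′)))

  block-sh : ∀ k i → Even (pos k (toℕ i)) → block k (sh i) ≡ block k i
  block-sh k i e = trans (cong (_/ 2) (pos-sh k i e)) (even⇒[1+c]/2≡c/2 (pos k (toℕ i)) e)

  block-step : ∀ k i i′ → Even (pos k (toℕ i)) → Odd (pos k (toℕ i′)) →
               block k i ≡ block k i′ → i′ ≡ sh i
  block-step k i i′ e o q = toℕ-injective (pos-injective k (toℕ<n i′) (toℕ<n (sh i))
    (trans (even-odd-/2⇒≡suc (pos k (toℕ i)) (pos k (toℕ i′)) e o q) (sym (pos-sh k i e))))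

  block-stay : ∀ k j j′ → SameParity (toℕ j) (toℕ j′) → block k j ≡ block k j′ → j ≡ j′
  block-stay k j j′ p q = toℕ-injective (pos-injective k (toℕ<n j) (toℕ<n j′)
    (%-/-injective 2 (SameParity⇒%≡ (pos k (toℕ j)) (pos k (toℕ j′))
                                     (pos-SameParity k {toℕ j} {toℕ j′} p)) q))

  val-sh₁ : ∀ k i j → Even (pos k (toℕ i)) → val 𝔊 k (i , j) ≡ val 𝔊 k (sh i , j)
  val-sh₁ k i j e = blocks⇒val k (sym (block-sh k i e)) refl

  val-sh₂ : ∀ k i j → Even (pos k (toℕ j)) → val 𝔊 k (i , j) ≡ val 𝔊 k (i , sh j)
  val-sh₂ k i j e = blocks⇒val k refl (sym (block-sh k j e))

  step-stay : ∀ k i j i′ j′ → Even (pos k (toℕ i)) → Odd (pos k (toℕ i′)) →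
              SameParity (toℕ j) (toℕ j′) →
              val 𝔊 k (i , j) ≡ val 𝔊 k (i′ , j′) → (i′ , j′) ≡ (sh i , j)
  step-stay k i j i′ j′ e o p s with val⇒blocks k s
  ... | bi , bj = cong₂ _,_ (block-step k i i′ e o bi) (sym (block-stay k j j′ p bj))

  stay-step : ∀ k i j i′ j′ → SameParity (toℕ i) (toℕ i′) →
              Even (pos k (toℕ j)) → Odd (pos k (toℕ j′)) →
              val 𝔊 k (i , j) ≡ val 𝔊 k (i′ , j′) → (i′ , j′) ≡ (i , sh j)
  stay-step k i j i′ j′ p e o s with val⇒blocks k s
  ... | bi , bj = cong₂ _,_ (sym (block-stay k i i′ p bi)) (block-step k j j′ e o bj)

  sH sV : C × C → C × C
  sH (i , j) = sh i , j
  sV (i , j) = i , sh j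

  φH-sH : ∀ x → φH ⟦ 𝔊 ⟧ x (sH x)
  φH-sH (i , j) with even⊎odd (toℕ i) | even⊎odd (toℕ j)
  ... | inj₁ e | inj₁ e′ = inj₁ (e , sh-even⇒odd i e , e′ , e′ , val-sh₁ ① i j e)
  ... | inj₂ o | inj₁ e′ = inj₂ (inj₁ (o , sh-odd⇒even i o , e′ , e′ , val-sh₁ ② i j (pm-odd (toℕ i) o)))
  ... | inj₁ e | inj₂ o′ = inj₂ (inj₂ (inj₁ (e , sh-even⇒odd i e , o′ , o′ , val-sh₁ ① i j e)))
  ... | inj₂ o | inj₂ o′ = inj₂ (inj₂ (inj₂ (o , sh-odd⇒even i o , o′ , o′ , val-sh₁ ② i j (pm-odd (toℕ i) o))))

  φV-sV : ∀ x → φV ⟦ 𝔊 ⟧ x (sV x)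
  φV-sV (i , j) with even⊎odd (toℕ i) | even⊎odd (toℕ j)
  ... | inj₁ e′ | inj₁ e = inj₁ (e′ , e′ , e , sh-even⇒odd j e , val-sh₂ ① i j e)
  ... | inj₂ o′ | inj₁ e = inj₂ (inj₁ (o′ , o′ , e , sh-even⇒odd j e , val-sh₂ ① i j e))
  ... | inj₁ e′ | inj₂ o = inj₂ (inj₂ (inj₁ (e′ , e′ , o , sh-odd⇒even j o , val-sh₂ ② i j (pm-odd (toℕ j) o))))
  ... | inj₂ o′ | inj₂ o = inj₂ (inj₂ (inj₂ (o′ , o′ , o , sh-odd⇒even j o , val-sh₂ ② i j (pm-odd (toℕ j) o))))

  φH-functional : ∀ x y → φH ⟦ 𝔊 ⟧ x y → y ≡ sH x
  φH-functional (i , j) (i′ , j′) (inj₁ (e , o′ , p , p′ , s)) =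
    step-stay ① i j i′ j′ e o′ (inj₁ (p , p′)) s
  φH-functional (i , j) (i′ , j′) (inj₂ (inj₁ (o , e′ , p , p′ , s))) =
    step-stay ② i j i′ j′ (pm-odd (toℕ i) o) (pm-even (toℕ i′) e′) (inj₁ (p , p′)) s
  φH-functional (i , j) (i′ , j′) (inj₂ (inj₂ (inj₁ (e , o′ , p , p′ , s)))) =
    step-stay ① i j i′ j′ e o′ (inj₂ (p , p′)) s
  φH-functional (i , j) (i′ , j′) (inj₂ (inj₂ (inj₂ (o , e′ , p , p′ , s)))) =
    step-stay ② i j i′ j′ (pm-odd (toℕ i) o) (pm-even (toℕ i′) e′) (inj₂ (p , p′)) s

  φV-functional : ∀ x y → φV ⟦ 𝔊 ⟧ x y → y ≡ sV x
  φV-functional (i , j) (i′ , j′) (inj₁ (p , p′ , e , o′ , s)) =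
    stay-step ① i j i′ j′ (inj₁ (p , p′)) e o′ s
  φV-functional (i , j) (i′ , j′) (inj₂ (inj₁ (p , p′ , e , o′ , s))) =
    stay-step ① i j i′ j′ (inj₂ (p , p′)) e o′ s
  φV-functional (i , j) (i′ , j′) (inj₂ (inj₂ (inj₁ (p , p′ , o , e′ , s)))) =
    stay-step ② i j i′ j′ (inj₁ (p , p′)) (pm-odd (toℕ j) o) (pm-even (toℕ j′) e′) s
  φV-functional (i , j) (i′ , j′) (inj₂ (inj₂ (inj₂ (p , p′ , o , e′ , s)))) =
    stay-step ② i j i′ j′ (inj₂ (p , p′)) (pm-odd (toℕ j) o) (pm-even (toℕ j′) e′) s

  ψ₁-𝔊 : ∀ x → ψ₁ ⟦ 𝔊 ⟧ x
  ψ₁-𝔊 (i , j) y x′ y′ (h , v , v′) =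
    subst₂ (φH ⟦ 𝔊 ⟧) (sym (φV-functional (i , j) x′ v)) (sym y′≡) (φH-sH (i , sh j))
    where
      y′≡ : y′ ≡ (sh i , sh j)
      y′≡ = trans (φV-functional y y′ v′) (cong sV (φH-functional (i , j) y h))

  𝔊-global : Global-φgrid ⟦ 𝔊 ⟧
  𝔊-global = ψ₁-𝔊
           , (λ x → (sH x , φH-sH x) , (sV x , φV-sV x))
           , (λ (i , j) → even⊕odd (toℕ i) , even⊕odd (toℕ j))

Global-φgrid⇒GridLike : ∀ {n} (𝔄 : DataStructure (Fin (suc n))) → Global-φgrid ⟦ 𝔄 ⟧ →
                        GridLike (φH ⟦ 𝔄 ⟧) (φV ⟦ 𝔄 ⟧)
Global-φgrid⇒GridLike {n} 𝔄 (square , successors , _) =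
  successors⇒GridLike {R₁ = φH ⟦ 𝔄 ⟧} {R₂ = φV ⟦ 𝔄 ⟧} h v
    (λ x → proj₂ (proj₁ (successors x))) v-succ
    (λ {x} {y} r → square x y (v x) (v y) (r , v-succ x , v-succ y))
  where
    h v : Fin (suc n) → Fin (suc n)
    h x = proj₁ (proj₁ (successors x))
    v x = proj₁ (proj₂ (successors x))
    v-succ : ∀ x → φV ⟦ 𝔄 ⟧ x (v x)
    v-succ x = proj₂ (proj₂ (successors x))

lemma3p24 :
    (∀ (m : ℕ) .{{_ : NonZero m}} → Models-φgrid (𝔄grid m))
    × (∀ (n : ℕ) (𝔄 : DataStructure (Fin (suc n))) → Models-φgrid 𝔄
         → GridLike (φH ⟦ 𝔄 ⟧) (φV ⟦ 𝔄 ⟧))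
lemma3p24 =
    (λ m → Equivalence.from (φgrid-local⇔global (𝔄grid m)) (Grid.𝔊-global m))
  , (λ n 𝔄 ⊨φ → Global-φgrid⇒GridLike 𝔄 (Equivalence.to (φgrid-local⇔global 𝔄) ⊨φ))
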